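{- Let $p$ be a prime number and let $\xi \in \mathbb{Q}_p$. There do not exist two linearly independent integer pairs $(x_{1},y_{1})$ and $(x_{2},y_{2})$ which, setting $X_{i}=\max \{ |x_{i}|,|y_{i}|\}$ for $i=1,2$, satisfy $$|y_{i}\xi -x_{i}|_{p} < \frac{1}{2}X_{1}^{ -1} X_{2}^{ -1}, \quad i=1,2.$$ In particular, for any real number $X>1$, the system $$\max\{ |x|,|y|\}\leq X, \qquad |y \xi - x|_{p} < \frac{1}{2}X^{ -2}$$ does not have two linearly independent integer solutions $(x,y)$.
   Context: $|\cdot|_p$ is the $p$-adic absolute value on $\mathbb{Q}_p$ with $|p|_p=p^{ -1}$. -}

module Defs where

open import Data.Nat as ℕ using (ℕ; zero; suc)
open import Data.Integer as ℤ using (ℤ; +_; -[1+_])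
open import Data.Integer.Divisibility using () renaming (_∣_ to _∣ℤ_)
open import Data.Rational as ℚ using (ℚ)
open import Data.Product using (Σ; _×_)
open import Data.Unit using (⊤)
open import Relation.Nullary using (¬_)
open import Relation.Binary.PropositionalEquality using (_≡_)

-- Z_p, presented as a coherent sequence of approximations:
-- approx n is a representative of the residue mod p^n, and
-- approx (n+1) ≡ approx n  (mod p^n).
record ℤₚ (p : ℕ) : Set where
  field
    approx   : ℕ → ℤ
    coherent : ∀ n → (+ (p ℕ.^ n)) ∣ℤ (approx (suc n) ℤ.- approx n)
open ℤₚ public

-- Q_p = Z_p[1/p]: every element is p^(-k) * u with u ∈ Z_p.
record ℚₚ (p : ℕ) : Set where
  constructor _/p^_
  field
    unit : ℤₚ p
    den  : ℕ
open ℚₚ public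

-- The linear form y ξ - x in Q_p, for ξ = p^(-k) u :
-- y ξ - x = p^(-k) (y u - p^k x), and y u - p^k x ∈ Z_p has approximations
-- n ↦ y * approx u n - p^k * x.
linApprox : ∀ {p} → ℚₚ p → ℤ → ℤ → ℕ → ℤ
linApprox {p} (u /p^ k) x y n = y ℤ.* approx u n ℤ.- (+ (p ℕ.^ k)) ℤ.* x

-- An element p^(-k) w (w ∈ Z_p given by approximations g) lies in p^m Z_p,
-- i.e. its p-adic order is ≥ m, iff w ∈ p^(m+k) Z_p, i.e. (when m+k = j ≥ 0)
-- p^j divides g n for all n ≥ j.
OrdGeAux : ℕ → (ℕ → ℤ) → ℤ → Set
OrdGeAux p g (+ j)    = ∀ n → j ℕ.≤ n → (+ (p ℕ.^ j)) ∣ℤ g n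
OrdGeAux p g -[1+ _ ] = ⊤

-- | y ξ - x |_p ≤ p^(-m)
LinOrdGe : ∀ {p} → ℚₚ p → ℤ → ℤ → ℤ → Set
LinOrdGe {p} ξ x y m = OrdGeAux p (linApprox ξ x y) (m ℤ.+ (+ den ξ))

powℚ : ℚ → ℕ → ℚ
powℚ q zero    = ℚ.1ℚ
powℚ q (suc n) = q ℚ.* powℚ q n

-- R < p^m, i.e. p^(-m) < 1/R   (for m = k ≥ 0 : R < p^k ; for m = -(k+1) : R p^(k+1) < 1)
PowGt : ℕ → ℤ → ℚ → Set
PowGt p (+ k)     R = R ℚ.< powℚ ((+ p) ℚ./ 1) k
PowGt p -[1+ k ]  R = R ℚ.* powℚ ((+ p) ℚ./ 1) (suc k) ℚ.< ℚ.1ℚ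

-- | y ξ - x |_p < 1/R   (R > 0 rational).  Since |·|_p takes values in {0} ∪ p^ℤ,
-- this holds iff |y ξ - x|_p ≤ p^(-m) for some integer m with p^(-m) < 1/R.
LinAbsLtInv : ∀ {p} → ℚₚ p → ℤ → ℤ → ℚ → Set
LinAbsLtInv {p} ξ x y R = Σ ℤ λ m → PowGt p m R × LinOrdGe ξ x y m

height : ℤ → ℤ → ℕ
height x y = ℤ.∣ x ∣ ℕ.⊔ ℤ.∣ y ∣

LinIndep : ℤ → ℤ → ℤ → ℤ → Set
LinIndep x₁ y₁ x₂ y₂ = ¬ (x₁ ℤ.* y₂ ℤ.- x₂ ℤ.* y₁ ≡ + 0)

{-# OPTIONS --safe #-}
-- Let D = x₁y₂ − x₂y₁ ≠ 0.  Writing ξ = p^(−d) u, the forms Lᵢ = yᵢu − p^d xᵢ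
-- satisfy y₂L₁ − y₁L₂ = −p^d D, so if both |yᵢξ − xᵢ|_p ≤ p^(−k) then p^k divides D
-- and p^k ≤ |D| ≤ 2X₁X₂.  Since |·|_p only takes the values p^m, the hypothesis
-- |yᵢξ − xᵢ|_p < 1/(2X₁X₂) gives some kᵢ with |D| < p^kᵢ, a contradiction for
-- k = min(k₁, k₂).
module Submission where

open import Defs
open import Data.Empty using (⊥)
open import Data.Nat as ℕ using (ℕ; zero; suc)
open import Data.Nat.Coprimality using (1-coprimeTo) renaming (sym to coprime-sym)
open import Data.Nat.Divisibility as ℕ∣ using (_∣_)
open import Data.Nat.Primality using (Prime; prime⇒nonZero)
import Data.Nat.Properties as ℕ
import Data.Nat.Tactic.RingSolver as ℕ-Solver
open import Data.Integer as ℤ using (ℤ; +_; -[1+_])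
open import Data.Integer.Divisibility using () renaming (_∣_ to _∣ℤ_)
import Data.Integer.Divisibility.Signed as ℤ∣±
import Data.Integer.Properties as ℤ
import Data.Integer.Tactic.RingSolver as ℤ-Solver
open import Data.Rational as ℚ using (ℚ; mkℚ)
import Data.Rational.Properties as ℚ
import Data.Rational.Unnormalised as ℚᵘ
open import Data.Rational.Unnormalised.Properties using (≃-trans; ≃-sym)
open import Data.Product using (Σ; _×_; _,_)
open import Data.Sum using (inj₁; inj₂)
open import Relation.Nullary using (¬_; contradiction)
open import Relation.Binary.PropositionalEquality

fromℕ : ℕ → ℚ
fromℕ n = + n ℚ./ 1

fromℕ≡mkℚ : ∀ n → fromℕ n ≡ mkℚ (+ n) 0 (coprime-sym (1-coprimeTo n))
fromℕ≡mkℚ n = ℚ.normalize-coprime (coprime-sym (1-coprimeTo n))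

fromℕ-cancel-< : ∀ {m n} → fromℕ m ℚ.< fromℕ n → m ℕ.< n
fromℕ-cancel-< {m} {n} m<n rewrite fromℕ≡mkℚ m | fromℕ≡mkℚ n with m<n
... | ℚ.*<* m*1<n*1 rewrite ℤ.*-identityʳ (+ m) | ℤ.*-identityʳ (+ n) = ℤ.drop‿+<+ m*1<n*1

fromℕ-mono-≤ : ∀ {m n} → m ℕ.≤ n → fromℕ m ℚ.≤ fromℕ n
fromℕ-mono-≤ {m} {n} m≤n rewrite fromℕ≡mkℚ m | fromℕ≡mkℚ n =
  ℚ.*≤* (subst₂ ℤ._≤_ (sym (ℤ.*-identityʳ (+ m))) (sym (ℤ.*-identityʳ (+ n))) (ℤ.+≤+ m≤n))

fromℕ-homo-* : ∀ m n → fromℕ (m ℕ.* n) ≡ fromℕ m ℚ.* fromℕ n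
fromℕ-homo-* m n = ℚ.toℚᵘ-injective (≃-trans unnormalised (≃-sym (ℚ.toℚᵘ-homo-* (fromℕ m) (fromℕ n))))
  where
  unnormalised : ℚ.toℚᵘ (fromℕ (m ℕ.* n)) ℚᵘ.≃ ℚ.toℚᵘ (fromℕ m) ℚᵘ.* ℚ.toℚᵘ (fromℕ n)
  unnormalised rewrite fromℕ≡mkℚ m | fromℕ≡mkℚ n | fromℕ≡mkℚ (m ℕ.* n) =
    ℚᵘ.*≡* (cong (ℤ._* + 1) (ℤ.pos-* m n))

fromℕ-nonNeg : ∀ n → ℚ.NonNegative (fromℕ n)
fromℕ-nonNeg n = ℚ.normalize-nonNeg n 1

powℚ-fromℕ : ∀ p k → powℚ (fromℕ p) k ≡ fromℕ (p ℕ.^ k)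
powℚ-fromℕ p zero    = refl
powℚ-fromℕ p (suc k) = trans (cong (fromℕ p ℚ.*_) (powℚ-fromℕ p k)) (sym (fromℕ-homo-* p (p ℕ.^ k)))

fromℕ-*-mono-≤ : ∀ m n {q r} → fromℕ m ℚ.≤ q → fromℕ n ℚ.≤ r → fromℕ (m ℕ.* n) ℚ.≤ q ℚ.* r
fromℕ-*-mono-≤ m n {q} {r} m≤q n≤r = begin
  fromℕ (m ℕ.* n)     ≡⟨ fromℕ-homo-* m n ⟩
  fromℕ m ℚ.* fromℕ n ≤⟨ ℚ.*-monoʳ-≤-nonNeg (fromℕ n) {{fromℕ-nonNeg n}} m≤q ⟩
  q ℚ.* fromℕ n       ≤⟨ ℚ.*-monoˡ-≤-nonNeg q {{q-nonNeg}} n≤r ⟩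
  q ℚ.* r             ∎
  where
  open ℚ.≤-Reasoning
  q-nonNeg : ℚ.NonNegative q
  q-nonNeg = ℚ.nonNegative (ℚ.≤-trans (ℚ.nonNegative⁻¹ (fromℕ m) {{fromℕ-nonNeg m}}) m≤q)

^-monoʳ-∣ : ∀ p {m n} → m ℕ.≤ n → p ℕ.^ m ∣ p ℕ.^ n
^-monoʳ-∣ p {m} {n} m≤n = subst (p ℕ.^ m ∣_)
  (trans (sym (ℕ.^-distribˡ-+-* p m (n ℕ.∸ m))) (cong (p ℕ.^_) (ℕ.m+[n∸m]≡n m≤n)))
  (ℕ∣.m∣m*n (p ℕ.^ (n ℕ.∸ m)))

det : ℤ → ℤ → ℤ → ℤ → ℤ
det x₁ y₁ x₂ y₂ = x₁ ℤ.* y₂ ℤ.- x₂ ℤ.* y₁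

∣det∣≤2*height*height : ∀ x₁ y₁ x₂ y₂ →
  ℤ.∣ det x₁ y₁ x₂ y₂ ∣ ℕ.≤ 2 ℕ.* height x₁ y₁ ℕ.* height x₂ y₂
∣det∣≤2*height*height x₁ y₁ x₂ y₂ = begin
  ℤ.∣ x₁ ℤ.* y₂ ℤ.- x₂ ℤ.* y₁ ∣          ≤⟨ ℤ.∣i-j∣≤∣i∣+∣j∣ (x₁ ℤ.* y₂) (x₂ ℤ.* y₁) ⟩
  ℤ.∣ x₁ ℤ.* y₂ ∣ ℕ.+ ℤ.∣ x₂ ℤ.* y₁ ∣     ≡⟨ cong₂ ℕ._+_ (ℤ.abs-* x₁ y₂) (ℤ.abs-* x₂ y₁) ⟩
  ∣x₁∣ ℕ.* ∣y₂∣ ℕ.+ ∣x₂∣ ℕ.* ∣y₁∣         ≤⟨ ℕ.+-mono-≤ (ℕ.*-mono-≤ (ℕ.m≤m⊔n ∣x₁∣ ∣y₁∣) (ℕ.m≤n⊔m ∣x₂∣ ∣y₂∣))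
                                                         (ℕ.*-mono-≤ (ℕ.m≤m⊔n ∣x₂∣ ∣y₂∣) (ℕ.m≤n⊔m ∣x₁∣ ∣y₁∣)) ⟩
  H₁ ℕ.* H₂ ℕ.+ H₂ ℕ.* H₁                 ≡⟨ m*n+n*m≡2*m*n H₁ H₂ ⟩
  2 ℕ.* H₁ ℕ.* H₂                         ∎
  where
  open ℕ.≤-Reasoning
  ∣x₁∣ ∣y₁∣ ∣x₂∣ ∣y₂∣ H₁ H₂ : ℕ
  ∣x₁∣ = ℤ.∣ x₁ ∣; ∣y₁∣ = ℤ.∣ y₁ ∣; ∣x₂∣ = ℤ.∣ x₂ ∣; ∣y₂∣ = ℤ.∣ y₂ ∣
  H₁ = height x₁ y₁
  H₂ = height x₂ y₂
  m*n+n*m≡2*m*n : ∀ m n → m ℕ.* n ℕ.+ n ℕ.* m ≡ 2 ℕ.* m ℕ.* n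
  m*n+n*m≡2*m*n = ℕ-Solver.solve-∀

eliminate-u : ∀ u P x₁ y₁ x₂ y₂ →
  y₂ ℤ.* (y₁ ℤ.* u ℤ.- P ℤ.* x₁) ℤ.- y₁ ℤ.* (y₂ ℤ.* u ℤ.- P ℤ.* x₂) ≡ ℤ.- (P ℤ.* (x₁ ℤ.* y₂ ℤ.- x₂ ℤ.* y₁))
eliminate-u = ℤ-Solver.solve-∀

^∣forms⇒^∣det : ∀ p .{{_ : ℕ.NonZero p}} j d u x₁ y₁ x₂ y₂ →
  + (p ℕ.^ (j ℕ.+ d)) ∣ℤ y₁ ℤ.* u ℤ.- + (p ℕ.^ d) ℤ.* x₁ →
  + (p ℕ.^ (j ℕ.+ d)) ∣ℤ y₂ ℤ.* u ℤ.- + (p ℕ.^ d) ℤ.* x₂ →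
  p ℕ.^ j ∣ ℤ.∣ det x₁ y₁ x₂ y₂ ∣
^∣forms⇒^∣det p j d u x₁ y₁ x₂ y₂ ∣L₁ ∣L₂ = ℕ∣.*-cancelˡ-∣ (p ℕ.^ d) {{ℕ.m^n≢0 p d}} ∣pᵈD
  where
  D : ℤ
  D = det x₁ y₁ x₂ y₂
  ∣-pᵈD : + (p ℕ.^ (j ℕ.+ d)) ℤ∣±.∣ ℤ.- (+ (p ℕ.^ d) ℤ.* D)
  ∣-pᵈD = subst (+ (p ℕ.^ (j ℕ.+ d)) ℤ∣±.∣_) (eliminate-u u (+ (p ℕ.^ d)) x₁ y₁ x₂ y₂)
    (ℤ∣±.∣m∣n⇒∣m-n (ℤ∣±.∣n⇒∣m*n y₂ (ℤ∣±.∣ᵤ⇒∣ ∣L₁)) (ℤ∣±.∣n⇒∣m*n y₁ (ℤ∣±.∣ᵤ⇒∣ ∣L₂)))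
  ∣pᵈD : p ℕ.^ d ℕ.* p ℕ.^ j ∣ p ℕ.^ d ℕ.* ℤ.∣ D ∣
  ∣pᵈD = subst₂ _∣_
    (trans (ℕ.^-distribˡ-+-* p j d) (ℕ.*-comm (p ℕ.^ j) (p ℕ.^ d)))
    (trans (ℤ.∣-i∣≡∣i∣ (+ (p ℕ.^ d) ℤ.* D)) (ℤ.abs-* (+ (p ℕ.^ d)) D))
    (ℤ∣±.∣⇒∣ᵤ ∣-pᵈD)

LinOrdGe⇒^∣ : ∀ {p} (ξ : ℚₚ p) x y {j k} N → LinOrdGe ξ x y (+ k) → j ℕ.≤ k → k ℕ.+ den ξ ℕ.≤ N →
  + (p ℕ.^ (j ℕ.+ den ξ)) ∣ℤ linApprox ξ x y N
LinOrdGe⇒^∣ {p} ξ x y N ord j≤k k+d≤N =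
  ℕ∣.∣-trans (^-monoʳ-∣ p (ℕ.+-monoˡ-≤ (den ξ) j≤k)) (ord N k+d≤N)

PowGt⇒exponent : ∀ p .{{_ : ℕ.NonZero p}} {D R} m → 1 ℕ.≤ D → fromℕ D ℚ.≤ R → PowGt p m R →
  Σ ℕ λ k → m ≡ + k × D ℕ.< p ℕ.^ k
PowGt⇒exponent p {D} {R} (+ k) _ D≤R R<pᵏ =
  k , refl , fromℕ-cancel-< (ℚ.≤-<-trans D≤R (subst (R ℚ.<_) (powℚ-fromℕ p k) R<pᵏ))
PowGt⇒exponent p {D} {R} -[1+ k ] 1≤D D≤R Rpᵏ⁺¹<1 = contradiction 1<1 (ℚ.<-irrefl refl)
  where
  open ℚ.≤-Reasoning
  Q : ℕ
  Q = p ℕ.^ suc k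
  1<1 : fromℕ 1 ℚ.< fromℕ 1
  1<1 = begin-strict
    fromℕ 1             ≤⟨ fromℕ-mono-≤ (ℕ.*-mono-≤ 1≤D (ℕ.m^n>0 p (suc k))) ⟩
    fromℕ (D ℕ.* Q)     ≡⟨ fromℕ-homo-* D Q ⟩
    fromℕ D ℚ.* fromℕ Q ≤⟨ ℚ.*-monoʳ-≤-nonNeg (fromℕ Q) {{fromℕ-nonNeg Q}} D≤R ⟩
    R ℚ.* fromℕ Q       <⟨ subst (λ q → R ℚ.* q ℚ.< fromℕ 1) (powℚ-fromℕ p (suc k)) Rpᵏ⁺¹<1 ⟩
    fromℕ 1             ∎

LinAbsLtInv⇒LinOrdGe : ∀ p .{{_ : ℕ.NonZero p}} (ξ : ℚₚ p) x y {D R} →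
  1 ℕ.≤ D → fromℕ D ℚ.≤ R → LinAbsLtInv ξ x y R →
  Σ ℕ λ k → D ℕ.< p ℕ.^ k × LinOrdGe ξ x y (+ k)
LinAbsLtInv⇒LinOrdGe p ξ x y 1≤D D≤R (m , pᵐ>R , ord) with PowGt⇒exponent p m 1≤D D≤R pᵐ>R
... | k , refl , D<pᵏ = k , D<pᵏ , ord

LinIndep⇒∣det∣>0 : ∀ x₁ y₁ x₂ y₂ → LinIndep x₁ y₁ x₂ y₂ → 1 ℕ.≤ ℤ.∣ det x₁ y₁ x₂ y₂ ∣
LinIndep⇒∣det∣>0 _ _ _ _ indep = ℕ.n≢0⇒n>0 (λ D≡0 → indep (ℤ.∣i∣≡0⇒i≡0 D≡0))

no-independent-pair : ∀ p .{{_ : ℕ.NonZero p}} (ξ : ℚₚ p) x₁ y₁ x₂ y₂ R →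
  LinIndep x₁ y₁ x₂ y₂ → fromℕ ℤ.∣ det x₁ y₁ x₂ y₂ ∣ ℚ.≤ R →
  LinAbsLtInv ξ x₁ y₁ R → LinAbsLtInv ξ x₂ y₂ R → ⊥
no-independent-pair p ξ x₁ y₁ x₂ y₂ R indep D≤R small₁ small₂
  with LinAbsLtInv⇒LinOrdGe p ξ x₁ y₁ (LinIndep⇒∣det∣>0 x₁ y₁ x₂ y₂ indep) D≤R small₁
     | LinAbsLtInv⇒LinOrdGe p ξ x₂ y₂ (LinIndep⇒∣det∣>0 x₁ y₁ x₂ y₂ indep) D≤R small₂
... | k₁ , D<pᵏ¹ , ord₁ | k₂ , D<pᵏ² , ord₂ = ℕ.<⇒≱ D<pʲ (ℕ∣.∣⇒≤ {{D≢0}} pʲ∣D)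
  where
  D j N : ℕ
  D = ℤ.∣ det x₁ y₁ x₂ y₂ ∣
  D≢0 : ℕ.NonZero D
  D≢0 = ℕ.>-nonZero (LinIndep⇒∣det∣>0 x₁ y₁ x₂ y₂ indep)
  j = k₁ ℕ.⊓ k₂
  N = k₁ ℕ.⊔ k₂ ℕ.+ den ξ
  pʲ∣D : p ℕ.^ j ∣ D
  pʲ∣D = ^∣forms⇒^∣det p j (den ξ) (approx (unit ξ) N) x₁ y₁ x₂ y₂
    (LinOrdGe⇒^∣ ξ x₁ y₁ N ord₁ (ℕ.m⊓n≤m k₁ k₂) (ℕ.+-monoˡ-≤ (den ξ) (ℕ.m≤m⊔n k₁ k₂)))
    (LinOrdGe⇒^∣ ξ x₂ y₂ N ord₂ (ℕ.m⊓n≤n k₁ k₂) (ℕ.+-monoˡ-≤ (den ξ) (ℕ.m≤n⊔m k₁ k₂)))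
  D<pʲ : D ℕ.< p ℕ.^ j
  D<pʲ with ℕ.⊓-sel k₁ k₂
  ... | inj₁ j≡k₁ = subst (λ i → D ℕ.< p ℕ.^ i) (sym j≡k₁) D<pᵏ¹
  ... | inj₂ j≡k₂ = subst (λ i → D ℕ.< p ℕ.^ i) (sym j≡k₂) D<pᵏ²

lemma4p1 : (p : ℕ) → Prime p → (ξ : ℚₚ p) →
    (¬ (Σ (ℤ × ℤ × ℤ × ℤ) λ { (x₁ , y₁ , x₂ , y₂) →
          LinIndep x₁ y₁ x₂ y₂
          × LinAbsLtInv ξ x₁ y₁ ((+ (2 ℕ.* height x₁ y₁ ℕ.* height x₂ y₂)) ℚ./ 1)
          × LinAbsLtInv ξ x₂ y₂ ((+ (2 ℕ.* height x₁ y₁ ℕ.* height x₂ y₂)) ℚ./ 1) }))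
    × ((X : ℚ) → ℚ.1ℚ ℚ.< X →
        ¬ (Σ (ℤ × ℤ × ℤ × ℤ) λ { (x₁ , y₁ , x₂ , y₂) →
          LinIndep x₁ y₁ x₂ y₂
          × ((+ height x₁ y₁) ℚ./ 1) ℚ.≤ X
          × ((+ height x₂ y₂) ℚ./ 1) ℚ.≤ X
          × LinAbsLtInv ξ x₁ y₁ ((+ 2) ℚ./ 1 ℚ.* X ℚ.* X)
          × LinAbsLtInv ξ x₂ y₂ ((+ 2) ℚ./ 1 ℚ.* X ℚ.* X) }))
lemma4p1 p p-prime ξ =
  (λ { ((x₁ , y₁ , x₂ , y₂) , indep , small₁ , small₂) →
       no-independent-pair p {{p≢0}} ξ x₁ y₁ x₂ y₂ _ indep
         (fromℕ-mono-≤ (∣det∣≤2*height*height x₁ y₁ x₂ y₂)) small₁ small₂ })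
  , λ { X _ ((x₁ , y₁ , x₂ , y₂) , indep , H₁≤X , H₂≤X , small₁ , small₂) →
       no-independent-pair p {{p≢0}} ξ x₁ y₁ x₂ y₂ _ indep
         (ℚ.≤-trans (fromℕ-mono-≤ (∣det∣≤2*height*height x₁ y₁ x₂ y₂))
           (fromℕ-*-mono-≤ (2 ℕ.* height x₁ y₁) (height x₂ y₂)
             (fromℕ-*-mono-≤ 2 (height x₁ y₁) ℚ.≤-refl H₁≤X) H₂≤X))
         small₁ small₂ }
  where
  p≢0 : ℕ.NonZero p
  p≢0 = prime⇒nonZero p-prime
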